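{- Let $A$ be a set of $k\geq 2$ positive integers and let $H$ be a set of $r\geq 2$ positive integers with $\max(H)=h_{r}$. If $|HA| = h_{r}(k-1)+r$, then $H$ is an arithmetic progression with some common difference $d$, and $A$ is an arithmetic progression with common difference $d\cdot \min(A)$.
   Context: For a positive integer $h$ and a finite set $A$ of integers, $hA$ denotes the set of all integers expressible as a sum of $h$ (not necessarily distinct) elements of $A$. For a finite set $H$ of positive integers, $HA := \bigcup_{h\in H} hA$. -}

module Defs where

open import Data.Nat using (ℕ; zero; suc; _+_; _*_; _<_)
open import Data.Nat.Properties using (_≟_)
open import Data.List using (List; []; _∷_; concatMap; map; length; deduplicate)
open import Data.List.Membership.Propositional using (_∈_)
open import Data.Product using (∃; _×_)
open import Function.Bundles using (_⇔_)
open import Relation.Binary.PropositionalEquality using (_≡_)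

-- Finite sets of positive integers are represented as duplicate-free lists of ℕ.

sumset : List ℕ → List ℕ → List ℕ
sumset X Y = concatMap (λ x → map (x +_) Y) X

_·_ : ℕ → List ℕ → List ℕ
zero · A = 0 ∷ []
suc h · A = sumset A (h · A)

HA : List ℕ → List ℕ → List ℕ
HA H A = concatMap (λ h → h · A) H

cardHA : List ℕ → List ℕ → ℕ
cardHA H A = length (deduplicate _≟_ (HA H A))

IsAP : ℕ → List ℕ → Set
IsAP d S = ∃ λ a → ∀ x → (x ∈ S ⇔ ∃ λ i → i < length S × x ≡ a + i * d)

-- Sort A as a₀ < ⋯ < a_{k−1}. Besides the multiples h·a₀ (h ∈ H), HA contains the chain of
-- h_r·A that climbs from h_r·a₀ to h_r·a_{k−1} by trading one summand a_i for a_{i+1} at a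
-- time: r + h_r(k−1) distinct elements, so under the hypothesis they exhaust HA. Every element
-- of h_r·A above h_r·a₀ then lies on the chain, and as h_r ≥ 2 this forces all gaps of A to
-- equal δ = a₁ − a₀. For q ∈ H below h_r, the element q·a₀ + δ of qA lies below the chain, so
-- it is a multiple y·a₀ with y ∈ H. Hence δ = e·a₀ with e > 0, and H, being closed under
-- adding e below its maximum, is a progression of difference e.

module Submission where

open import Defs
open import Data.Empty using (⊥-elim)
open import Data.List using (List; []; _∷_; _++_; length; map; filter; applyUpTo; upTo; deduplicate)
open import Data.List.Extrema.Nat using (min; max; argmin-sel; min≤xs; xs≤max)
open import Data.List.Membership.Propositional using (_∈_)
open import Data.List.Membership.Propositional.Properties
  using ( ∈-++⁻; ∈-map⁺; ∈-map⁻; ∈-concatMap⁺; ∈-applyUpTo⁺; ∈-applyUpTo⁻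
        ; ∈-filter⁺; ∈-filter⁻; ∈-upTo⁺; ∈-deduplicate⁺)
open import Data.List.Properties using (length-++; length-map; length-applyUpTo; filter-notAll)
open import Data.List.Relation.Binary.Subset.Propositional using (_⊆_)
open import Data.List.Relation.Unary.All as All using (All; []; _∷_)
open import Data.List.Relation.Unary.All.Properties using (¬Any⇒All¬)
open import Data.List.Relation.Unary.AllPairs as AllPairs using (AllPairs; []; _∷_)
import Data.List.Relation.Unary.AllPairs.Properties as AllPairs
open import Data.List.Relation.Unary.Any as Any using (here; there)
open import Data.List.Relation.Unary.Linked using (Linked; []; [-]; _∷_)
open import Data.List.Relation.Unary.Unique.Propositional using (Unique)
import Data.List.Relation.Unary.Unique.Propositional.Properties as Unique
open import Data.Nat using (ℕ; zero; suc; _+_; _*_; _∸_; _≤_; _<_; z≤n; s≤s; s≤s⁻¹; _<?_; NonZero; >-nonZero)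
open import Data.Nat.Properties
open import Data.List.Membership.DecPropositional _≟_ using (_∈?_)
open import Data.Nat.Tactic.RingSolver using (solve-∀)
open import Data.Product using (∃; _×_; _,_)
open import Data.Sum using (_⊎_; inj₁; inj₂)
open import Function.Bundles using (_⇔_; mk⇔; Equivalence)
import Function.Properties.Equivalence as ⇔
open import Relation.Binary.PropositionalEquality
open import Relation.Nullary using (yes; no; ¬?)

Unique⇒length≤ : ∀ {xs ys : List ℕ} → Unique xs → xs ⊆ ys → length xs ≤ length ys
Unique⇒length≤ {[]} _ _ = z≤n
Unique⇒length≤ {x ∷ xs} {ys} (x∉xs ∷ xs!) xs⊆ys = ≤-trans
  (s≤s (Unique⇒length≤ xs! xs⊆ys-x))
  (filter-notAll (λ y → ¬? (x ≟ y)) ys (Any.map (λ x≡y x≢y → x≢y x≡y) (xs⊆ys (here refl))))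
  where
  xs⊆ys-x : xs ⊆ filter (λ y → ¬? (x ≟ y)) ys
  xs⊆ys-x y∈xs = ∈-filter⁺ (λ y → ¬? (x ≟ y)) (xs⊆ys (there y∈xs)) (All.lookup x∉xs y∈xs)

⊇-by-length : ∀ {xs ys : List ℕ} → Unique ys → ys ⊆ xs
            → length (deduplicate _≟_ xs) ≤ length ys → xs ⊆ ys
⊇-by-length {xs} {ys} ys! ys⊆xs short {x} x∈xs with x ∈? ys
... | yes x∈ys = x∈ys
... | no  x∉ys = ⊥-elim (1+n≰n (≤-trans (Unique⇒length≤ (¬Any⇒All¬ ys x∉ys ∷ ys!) x∷ys⊆) short))
  where
  x∷ys⊆ : x ∷ ys ⊆ deduplicate _≟_ xs
  x∷ys⊆ (here refl) = ∈-deduplicate⁺ _≟_ x∈xs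
  x∷ys⊆ (there y∈ys) = ∈-deduplicate⁺ _≟_ (ys⊆xs y∈ys)

∃-below-max : ∀ {xs : List ℕ} {m} → Unique xs → 2 ≤ length xs → (∀ x → x ∈ xs → x ≤ m)
            → ∃ λ q → q ∈ xs × q < m
∃-below-max {_ ∷ []} _ (s≤s ()) _
∃-below-max {x ∷ y ∷ _} {m} ((x≢y ∷ _) ∷ _) _ ≤m with x ≟ m
... | yes refl = y , there (here refl) , ≤∧≢⇒< (≤m y (there (here refl))) (λ y≡x → x≢y (sym y≡x))
... | no  x≢m  = x , here refl , ≤∧≢⇒< (≤m x (here refl)) x≢m

∃-minimum : ∀ {xs : List ℕ} {x} → x ∈ xs → ∃ λ m → m ∈ xs × (∀ y → y ∈ xs → m ≤ y)
∃-minimum {xs} {x} x∈xs = min x xs , min∈xs , λ y y∈xs → All.lookup (min≤xs x xs) y∈xs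
  where
  min∈xs : min x xs ∈ xs
  min∈xs with argmin-sel (λ z → z) x xs
  ... | inj₁ min≡x = subst (_∈ xs) (sym min≡x) x∈xs
  ... | inj₂ min∈  = min∈

ascending : List ℕ → List ℕ
ascending xs = filter (_∈? xs) (upTo (suc (max 0 xs)))

ascending-↑ : ∀ xs → AllPairs _<_ (ascending xs)
ascending-↑ xs = AllPairs.filter⁺ (_∈? xs) (AllPairs.applyUpTo⁺₁ (λ i → i) _ (λ i<j _ → i<j))

∈-ascending⇔ : ∀ xs {x} → x ∈ ascending xs ⇔ x ∈ xs
∈-ascending⇔ xs = mk⇔
  (λ x∈ → let _ , x∈xs = ∈-filter⁻ (_∈? xs) x∈ in x∈xs)
  (λ x∈xs → ∈-filter⁺ (_∈? xs) (∈-upTo⁺ (s≤s (All.lookup (xs≤max 0 xs) x∈xs))) x∈xs)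

length-ascending : ∀ {xs} → Unique xs → length (ascending xs) ≡ length xs
length-ascending {xs} xs! = ≤-antisym
  (Unique⇒length≤ (AllPairs.map <⇒≢ (ascending-↑ xs)) (Equivalence.to (∈-ascending⇔ xs)))
  (Unique⇒length≤ xs! (Equivalence.from (∈-ascending⇔ xs)))

head-≤ : ∀ {a x} {xs : List ℕ} → AllPairs _<_ (a ∷ xs) → x ∈ a ∷ xs → a ≤ x
head-≤ _ (here refl) = ≤-refl
head-≤ (a<xs ∷ _) (there x∈xs) = <⇒≤ (All.lookup a<xs x∈xs)

∈-·-suc⁺ : ∀ {A : List ℕ} {a y} h → a ∈ A → y ∈ h · A → a + y ∈ suc h · A
∈-·-suc⁺ {A} h a∈A y∈hA = ∈-concatMap⁺ (λ a → map (a +_) (h · A)) (Any.map (λ { refl → ∈-map⁺ _ y∈hA }) a∈A)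

∈-·-*⁺ : ∀ {A : List ℕ} {a} h → a ∈ A → h * a ∈ h · A
∈-·-*⁺ zero    _   = here refl
∈-·-*⁺ (suc h) a∈A = ∈-·-suc⁺ h a∈A (∈-·-*⁺ h a∈A)

∈-·-mix⁺ : ∀ {A : List ℕ} {a b} i j → a ∈ A → b ∈ A → i * a + j * b ∈ (i + j) · A
∈-·-mix⁺ zero    j _   b∈A = ∈-·-*⁺ j b∈A
∈-·-mix⁺ {A} {a} {b} (suc i) j a∈A b∈A = subst (_∈ suc (i + j) · A) (sym (+-assoc a (i * a) (j * b)))
  (∈-·-suc⁺ (i + j) a∈A (∈-·-mix⁺ i j a∈A b∈A))

∈-HA⁺ : ∀ {H A : List ℕ} {h x} → h ∈ H → x ∈ h · A → x ∈ HA H A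
∈-HA⁺ {H} {A} h∈H x∈hA = ∈-concatMap⁺ (λ h → h · A) (Any.map (λ { refl → x∈hA }) h∈H)

-- The chain in hA

k*n≡k*m+k*[n∸m] : ∀ k {m n} → m ≤ n → k * n ≡ k * m + k * (n ∸ m)
k*n≡k*m+k*[n∸m] k {m} {n} m≤n = trans (cong (k *_) (sym (m+[n∸m]≡n m≤n))) (*-distribˡ-+ k m (n ∸ m))

-- h·a + (m+1)(b − a) = (h−m−1)·a + (m+1)·b: one more summand a is replaced by b at each step.
block : ℕ → ℕ → ℕ → List ℕ
block h a b = applyUpTo (λ m → h * a + suc m * (b ∸ a)) h

-- For a₀ < a₁ < ⋯ < a_{k-1} the chain climbs from h·a₀ to h·a_{k-1} through h(k-1)
-- elements of hA; the bottom element h·a₀ itself is left out.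
chain : ℕ → List ℕ → List ℕ
chain h []           = []
chain h (a ∷ [])     = []
chain h (a ∷ b ∷ xs) = block h a b ++ chain h (b ∷ xs)

block-above : ∀ {h a b x} → a < b → x ∈ block h a b → h * a < x
block-above {h} {a} {b} a<b x∈ with ∈-applyUpTo⁻ _ x∈
... | m , _ , refl = m<m+n (h * a) (<-≤-trans (m<n⇒0<n∸m a<b) (m≤m+n (b ∸ a) (m * (b ∸ a))))

block-below : ∀ {h a b x} → a ≤ b → x ∈ block h a b → x ≤ h * b
block-below {h} {a} {b} a≤b x∈ with ∈-applyUpTo⁻ _ x∈
... | m , m<h , refl =
  ≤-trans (+-monoʳ-≤ (h * a) (*-monoˡ-≤ (b ∸ a) m<h)) (≤-reflexive (sym (k*n≡k*m+k*[n∸m] h a≤b)))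

block-↑ : ∀ {h a b} → a < b → AllPairs _<_ (block h a b)
block-↑ {h} {a} {b} a<b = AllPairs.applyUpTo⁺₁ _ h
  (λ i<j _ → +-monoʳ-< (h * a) (*-monoˡ-< (b ∸ a) {{>-nonZero (m<n⇒0<n∸m a<b)}} (s≤s i<j)))

block⊆· : ∀ {A : List ℕ} {h a b} → a ≤ b → a ∈ A → b ∈ A → block h a b ⊆ h · A
block⊆· {A} {h} {a} {b} a≤b a∈A b∈A x∈ with ∈-applyUpTo⁻ _ x∈
... | m , m<h , refl =
  subst₂ (λ x n → x ∈ n · A) mixture≡ (m∸n+n≡m m<h) (∈-·-mix⁺ (h ∸ suc m) (suc m) a∈A b∈A)
  where
  distribute : ∀ u j a d → u * a + j * (a + d) ≡ (u + j) * a + j * d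
  distribute = solve-∀
  mixture≡ : (h ∸ suc m) * a + suc m * b ≡ h * a + suc m * (b ∸ a)
  mixture≡ = begin
    (h ∸ suc m) * a + suc m * b               ≡⟨ cong ((h ∸ suc m) * a +_) (cong (suc m *_) (sym (m+[n∸m]≡n a≤b))) ⟩
    (h ∸ suc m) * a + suc m * (a + (b ∸ a))   ≡⟨ distribute (h ∸ suc m) (suc m) a (b ∸ a) ⟩
    (h ∸ suc m + suc m) * a + suc m * (b ∸ a) ≡⟨ cong (λ n → n * a + suc m * (b ∸ a)) (m∸n+n≡m m<h) ⟩
    h * a + suc m * (b ∸ a)                   ∎
    where open ≡-Reasoning

chain-above : ∀ {h a x} {xs : List ℕ} → AllPairs _<_ (a ∷ xs) → x ∈ chain h (a ∷ xs) → h * a < x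
chain-above {h} {a} {xs = b ∷ xs} ((a<b ∷ _) ∷ b↑) x∈ with ∈-++⁻ (block h a b) x∈
... | inj₁ x∈block = block-above a<b x∈block
... | inj₂ x∈chain = ≤-<-trans (*-monoʳ-≤ h (<⇒≤ a<b)) (chain-above b↑ x∈chain)

chain-≥ : ∀ {k a b y} {xs : List ℕ} → AllPairs _<_ (a ∷ b ∷ xs) → y ∈ chain (suc k) (a ∷ b ∷ xs)
        → suc k * a + (b ∸ a) ≤ y
chain-≥ {k} {a} {b} ((a<b ∷ _) ∷ b↑) y∈ with ∈-++⁻ (block (suc k) a b) y∈
... | inj₁ y∈block with ∈-applyUpTo⁻ (λ m → suc k * a + suc m * (b ∸ a)) y∈block
...   | m , _ , refl = +-monoʳ-≤ (suc k * a) (m≤m+n (b ∸ a) (m * (b ∸ a)))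
chain-≥ {k} {a} {b} ((a<b ∷ _) ∷ b↑) y∈ | inj₂ y∈chain = <⇒≤ (begin-strict
  suc k * a + (b ∸ a)            ≤⟨ +-monoʳ-≤ (suc k * a) (m≤m+n (b ∸ a) (k * (b ∸ a))) ⟩
  suc k * a + suc k * (b ∸ a)    ≡⟨ sym (k*n≡k*m+k*[n∸m] (suc k) (<⇒≤ a<b)) ⟩
  suc k * b                      <⟨ chain-above b↑ y∈chain ⟩
  _                              ∎)
  where open ≤-Reasoning

chain-↑ : ∀ {h} {xs : List ℕ} → AllPairs _<_ xs → AllPairs _<_ (chain h xs)
chain-↑ {xs = []} _ = []
chain-↑ {xs = _ ∷ []} _ = []
chain-↑ {h} {a ∷ b ∷ xs} ((a<b ∷ _) ∷ b↑) = AllPairs.++⁺ (block-↑ a<b) (chain-↑ b↑)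
  (All.tabulate λ y∈block → All.tabulate λ z∈chain →
    ≤-<-trans (block-below (<⇒≤ a<b) y∈block) (chain-above b↑ z∈chain))

length-chain : ∀ h a (xs : List ℕ) → length (chain h (a ∷ xs)) ≡ h * length xs
length-chain h a [] = sym (*-zeroʳ h)
length-chain h a (b ∷ xs) = begin
  length (block h a b ++ chain h (b ∷ xs))         ≡⟨ length-++ (block h a b) ⟩
  length (block h a b) + length (chain h (b ∷ xs)) ≡⟨ cong₂ _+_ (length-applyUpTo _ h) (length-chain h b xs) ⟩
  h + h * length xs                                ≡⟨ sym (*-suc h (length xs)) ⟩
  h * suc (length xs)                              ∎
  where open ≡-Reasoning

chain⊆· : ∀ {A : List ℕ} {h} {xs : List ℕ} → AllPairs _<_ xs → All (_∈ A) xs → chain h xs ⊆ h · A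
chain⊆· {xs = a ∷ b ∷ xs} ((a<b ∷ _) ∷ b↑) (a∈A ∷ b∈A ∷ xs⊆A) x∈ with ∈-++⁻ (block _ a b) x∈
... | inj₁ x∈block = block⊆· (<⇒≤ a<b) a∈A b∈A x∈block
... | inj₂ x∈chain = chain⊆· b↑ (b∈A ∷ xs⊆A) x∈chain

Step : ℕ → ℕ → ℕ → Set
Step d x y = y ≡ x + d

progression : ℕ → ℕ → ℕ → List ℕ
progression a d n = applyUpTo (λ i → a + i * d) n

progression-↑ : ∀ {a d} n → 0 < d → AllPairs _<_ (progression a d n)
progression-↑ {a} {d} n 0<d =
  AllPairs.applyUpTo⁺₁ _ n (λ i<j _ → +-monoʳ-< a (*-monoˡ-< d {{>-nonZero 0<d}} i<j))

progression-IsAP : ∀ a d n → IsAP d (progression a d n)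
progression-IsAP a d n = a , λ x → mk⇔
  (λ x∈ → let i , i<n , x≡ = ∈-applyUpTo⁻ f x∈ in i , subst (i <_) (sym |P|) i<n , x≡)
  (λ { (i , i<|P| , refl) → ∈-applyUpTo⁺ f (subst (i <_) |P| i<|P|) })
  where
  f : ℕ → ℕ
  f i = a + i * d
  |P| : length (applyUpTo f n) ≡ n
  |P| = length-applyUpTo f n

IsAP-resp : ∀ {d} {xs ys : List ℕ} → (∀ {x} → x ∈ xs ⇔ x ∈ ys) → length xs ≡ length ys
          → IsAP d ys → IsAP d xs
IsAP-resp {xs = xs} xs⇔ys |xs|≡|ys| (a , ys⇔) = a , λ x → mk⇔
  (λ x∈xs → let i , i< , x≡ = Equivalence.to (ys⇔ x) (Equivalence.to xs⇔ys x∈xs)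
            in i , subst (i <_) (sym |xs|≡|ys|) i< , x≡)
  (λ { (i , i< , x≡) →
        Equivalence.from xs⇔ys (Equivalence.from (ys⇔ x) (i , subst (i <_) |xs|≡|ys| i< , x≡)) })

Linked-Step⇒IsAP : ∀ {d} {xs : List ℕ} → Linked (Step d) xs → IsAP d xs
Linked-Step⇒IsAP [] = 0 , λ x → mk⇔ (λ ()) (λ { (_ , () , _) })
Linked-Step⇒IsAP {d} {a ∷ xs} linked = a , λ x → mk⇔ (to linked) (λ { (i , i< , x≡) → from linked i i< x≡ })
  where
  to : ∀ {a x xs} → Linked (Step d) (a ∷ xs) → x ∈ a ∷ xs → ∃ λ i → i < length (a ∷ xs) × x ≡ a + i * d
  to {a} _ (here refl) = 0 , s≤s z≤n , sym (+-identityʳ a)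
  to {a} (refl ∷ linked) (there x∈) with to linked x∈
  ... | i , i< , refl = suc i , s≤s i< , +-assoc a d (i * d)
  from : ∀ {a x xs} → Linked (Step d) (a ∷ xs) → ∀ i → i < length (a ∷ xs) → x ≡ a + i * d → x ∈ a ∷ xs
  from {a} _ zero _ x≡ = here (trans x≡ (+-identityʳ a))
  from {a} (refl ∷ linked) (suc i) (s≤s i<) x≡ =
    there (from linked i i< (trans x≡ (sym (+-assoc a d (i * d)))))

chain-of-Linked : ∀ {h d a x} {xs : List ℕ} → Linked (Step d) (a ∷ xs) → x ∈ chain h (a ∷ xs)
                → ∃ λ t → x ≡ h * a + suc t * d
chain-of-Linked {h} {d} {a} {xs = _ ∷ xs} (refl ∷ linked) x∈ with ∈-++⁻ (block h a (a + d)) x∈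
... | inj₁ x∈block with ∈-applyUpTo⁻ (λ m → h * a + suc m * (a + d ∸ a)) x∈block
...   | m , _ , refl = m , cong (λ d′ → h * a + suc m * d′) (m+n∸m≡n a d)
chain-of-Linked {h} {d} {a} (refl ∷ linked) x∈ | inj₂ x∈chain with chain-of-Linked linked x∈chain
... | t , refl = h + t , regroup h a d t
  where
  regroup : ∀ h a d t → h * (a + d) + suc t * d ≡ h * a + suc (h + t) * d
  regroup = solve-∀

module _ {H : List ℕ} {e top : ℕ} (0<e : 0 < e) (top∈H : top ∈ H) (H≤top : ∀ h → h ∈ H → h ≤ top)
         (closed : ∀ {h} → h ∈ H → h < top → h + e ∈ H) where

  private instance
    e≢0 : NonZero e
    e≢0 = >-nonZero 0<e

  reaches-top : ∀ {h} → h ∈ H → ∃ λ n → h + n * e ≡ top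
  reaches-top {h} h∈H = go (top ∸ h) h∈H ≤-refl
    where
    go : ∀ fuel {h} → h ∈ H → top ∸ h ≤ fuel → ∃ λ n → h + n * e ≡ top
    go fuel {h} h∈H _ with h <? top
    go fuel {h} h∈H _ | no h≮top = 0 , trans (+-identityʳ h) (≤-antisym (H≤top h h∈H) (≮⇒≥ h≮top))
    go zero {h} h∈H gap≤0 | yes h<top = ⊥-elim (<⇒≱ (m<n⇒0<n∸m h<top) gap≤0)
    go (suc fuel) {h} h∈H gap≤ | yes h<top with go fuel (closed h∈H h<top) shorter
      where
      shorter : top ∸ (h + e) ≤ fuel
      shorter = s≤s⁻¹ (<-≤-trans (∸-monoʳ-< (m<m+n h 0<e) (H≤top _ (closed h∈H h<top))) gap≤)
    ... | n , h+e+ne≡top = suc n , trans (sym (+-assoc h e (n * e))) h+e+ne≡top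

  module _ {lo N : ℕ} (lo∈H : lo ∈ H) (lo≤H : ∀ h → h ∈ H → lo ≤ h) (lo+Ne≡top : lo + N * e ≡ top) where

    progression⊆ : progression lo e (suc N) ⊆ H
    progression⊆ x∈P with ∈-applyUpTo⁻ (λ i → lo + i * e) x∈P
    ... | i , i<1+N , refl = lo+ie∈H (s≤s⁻¹ i<1+N)
      where
      lo+ie∈H : ∀ {i} → i ≤ N → lo + i * e ∈ H
      lo+ie∈H {zero} _ = subst (_∈ H) (sym (+-identityʳ lo)) lo∈H
      lo+ie∈H {suc i} i<N = subst (_∈ H) (trans (+-assoc lo (i * e) e) (cong (lo +_) (+-comm (i * e) e)))
        (closed (lo+ie∈H (<⇒≤ i<N)) (subst (lo + i * e <_) lo+Ne≡top (+-monoʳ-< lo (*-monoˡ-< e i<N))))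

    ⊆progression : H ⊆ progression lo e (suc N)
    ⊆progression {x} x∈H with reaches-top x∈H
    ... | n , x+ne≡top =
      subst (_∈ progression lo e (suc N)) (sym x≡) (∈-applyUpTo⁺ (λ i → lo + i * e) (s≤s (m∸n≤m N n)))
      where
      n≤N : n ≤ N
      n≤N = *-cancelʳ-≤ n N e (+-cancelˡ-≤ lo _ _
        (≤-trans (+-monoˡ-≤ (n * e) (lo≤H x x∈H)) (≤-reflexive (trans x+ne≡top (sym lo+Ne≡top)))))
      x≡ : x ≡ lo + (N ∸ n) * e
      x≡ = +-cancelʳ-≡ (n * e) x (lo + (N ∸ n) * e) (begin
        x + n * e                    ≡⟨ trans x+ne≡top (sym lo+Ne≡top) ⟩
        lo + N * e                   ≡⟨ cong (λ m → lo + m * e) (sym (m∸n+n≡m n≤N)) ⟩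
        lo + (N ∸ n + n) * e         ≡⟨ cong (lo +_) (*-distribʳ-+ e (N ∸ n) n) ⟩
        lo + ((N ∸ n) * e + n * e)   ≡⟨ sym (+-assoc lo _ _) ⟩
        lo + (N ∸ n) * e + n * e     ∎)
        where open ≡-Reasoning

  step-closed⇒IsAP : Unique H → IsAP e H
  step-closed⇒IsAP H! with ∃-minimum top∈H
  ... | lo , lo∈H , lo≤H with reaches-top lo∈H
  ... | N , lo+Ne≡top = IsAP-resp (mk⇔ H⊆P P⊆H)
    (≤-antisym (Unique⇒length≤ H! H⊆P) (Unique⇒length≤ (AllPairs.map <⇒≢ (progression-↑ (suc N) 0<e)) P⊆H))
    (progression-IsAP lo e (suc N))
    where
    P⊆H : progression lo e (suc N) ⊆ H
    P⊆H = progression⊆ lo∈H lo≤H lo+Ne≡top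
    H⊆P : H ⊆ progression lo e (suc N)
    H⊆P = ⊆progression lo∈H lo≤H lo+Ne≡top

-- Rigidity of the chain

ChainCovers : List ℕ → ℕ → ℕ → List ℕ → Set
ChainCovers A h a xs = ∀ {x} → x ∈ h · A → h * a < x → x ∈ chain h (a ∷ xs)

ChainCovers-tail : ∀ {A : List ℕ} {h a b xs} → a < b → ChainCovers A h a (b ∷ xs) → ChainCovers A h b xs
ChainCovers-tail {h = h} {a} {b} a<b covers x∈hA hb<x
  with ∈-++⁻ (block h a b) (covers x∈hA (≤-<-trans (*-monoʳ-≤ h (<⇒≤ a<b)) hb<x))
... | inj₁ x∈block = ⊥-elim (<⇒≱ hb<x (block-below (<⇒≤ a<b) x∈block))
... | inj₂ x∈chain = x∈chain

-- With d₁ = b − a and d₂ = c − b, the element x = a + c + k·b of (k+2)A lies above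
-- (k+2)a + (k+1)d₁ and below (k+2)b + d₂; the only chain element in between is (k+2)b.
equal-gaps : ∀ {A : List ℕ} {k a b c xs} → AllPairs _<_ (a ∷ b ∷ c ∷ xs) → a ∈ A → b ∈ A → c ∈ A
           → ChainCovers A (suc (suc k)) a (b ∷ c ∷ xs) → c ∸ b ≡ b ∸ a
equal-gaps {A} {k} {a} {b} {c} {xs} ((a<b ∷ _) ∷ b↑@((b<c ∷ _) ∷ _)) a∈A b∈A c∈A covers =
  locate (∈-++⁻ (block h a b) (covers x∈hA (m<m+n (h * a) 0<offset)))
  where
  h d₁ d₂ offset : ℕ
  h = suc (suc k)
  d₁ = b ∸ a
  d₂ = c ∸ b
  offset = suc k * d₁ + d₂
  0<offset : 0 < offset
  0<offset = <-≤-trans (m<n⇒0<n∸m b<c) (m≤n+m d₂ (suc k * d₁))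

  collect : ∀ k a d₁ d₂ → a + ((a + d₁ + d₂) + k * (a + d₁)) ≡ suc (suc k) * a + (suc k * d₁ + d₂)
  collect = solve-∀
  b≡ : b ≡ a + d₁
  b≡ = sym (m+[n∸m]≡n (<⇒≤ a<b))
  c≡ : c ≡ a + d₁ + d₂
  c≡ = trans (sym (m+[n∸m]≡n (<⇒≤ b<c))) (cong (_+ d₂) b≡)
  x∈hA : h * a + offset ∈ h · A
  x∈hA = subst (_∈ h · A) (trans (cong₂ (λ b c → a + (c + k * b)) b≡ c≡) (collect k a d₁ d₂))
    (∈-·-suc⁺ (suc k) a∈A (∈-·-suc⁺ k c∈A (∈-·-*⁺ k b∈A)))

  x<hb+d₂ : h * a + offset < h * b + d₂
  x<hb+d₂ = begin-strict
    h * a + (suc k * d₁ + d₂)       <⟨ +-monoʳ-< (h * a) (+-monoˡ-< d₂ (m<n+m (suc k * d₁) (m<n⇒0<n∸m a<b))) ⟩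
    h * a + (d₁ + suc k * d₁ + d₂)  ≡⟨ sym (+-assoc (h * a) (h * d₁) d₂) ⟩
    h * a + h * d₁ + d₂             ≡⟨ cong (_+ d₂) (sym (k*n≡k*m+k*[n∸m] h (<⇒≤ a<b))) ⟩
    h * b + d₂                      ∎
    where open ≤-Reasoning

  locate : h * a + offset ∈ block h a b ⊎ h * a + offset ∈ chain h (b ∷ c ∷ xs) → d₂ ≡ d₁
  locate (inj₂ x∈chain) = ⊥-elim (<⇒≱ x<hb+d₂ (chain-≥ b↑ x∈chain))
  locate (inj₁ x∈block) with ∈-applyUpTo⁻ (λ m → h * a + suc m * d₁) x∈block
  ... | m , m<h , x≡ =
    +-cancelˡ-≡ (suc k * d₁) d₂ d₁ (trans offset≡ (trans (cong (_* d₁) 1+m≡h) (+-comm d₁ (suc k * d₁))))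
    where
    offset≡ : offset ≡ suc m * d₁
    offset≡ = +-cancelˡ-≡ (h * a) _ _ x≡
    k<m : k < m
    k<m = s≤s⁻¹ (*-cancelʳ-< d₁ (suc k) (suc m)
      (≤-trans (m<m+n (suc k * d₁) (m<n⇒0<n∸m b<c)) (≤-reflexive offset≡)))
    1+m≡h : suc m ≡ h
    1+m≡h = cong suc (≤-antisym (s≤s⁻¹ m<h) k<m)

ChainCovers⇒Linked : ∀ {A : List ℕ} {h a b xs} → 2 ≤ h → AllPairs _<_ (a ∷ b ∷ xs) → All (_∈ A) (a ∷ b ∷ xs)
              → ChainCovers A h a (b ∷ xs) → Linked (Step (b ∸ a)) (a ∷ b ∷ xs)
ChainCovers⇒Linked {xs = []} _ ((a<b ∷ _) ∷ _) _ _ = sym (m+[n∸m]≡n (<⇒≤ a<b)) ∷ [-]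
ChainCovers⇒Linked {A} {a = a} {b} {c ∷ xs}
  2≤h@(s≤s (s≤s _)) S↑@((a<b ∷ _) ∷ b↑) (a∈A ∷ b∈A ∷ c∈A ∷ xs⊆A) covers =
  sym (m+[n∸m]≡n (<⇒≤ a<b)) ∷ subst (λ d → Linked (Step d) (b ∷ c ∷ xs))
    (equal-gaps S↑ a∈A b∈A c∈A covers)
    (ChainCovers⇒Linked 2≤h b↑ (b∈A ∷ c∈A ∷ xs⊆A) (ChainCovers-tail {A} {xs = c ∷ xs} a<b covers))

-- The extremal case |HA| = h_r(k-1) + r

module Extremal
  {A H : List ℕ} {g s hr : ℕ} {xs : List ℕ}
  (S↑ : AllPairs _<_ (g ∷ s ∷ xs)) (S⊆A : All (_∈ A) (g ∷ s ∷ xs)) (0<g : 0 < g)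
  (H! : Unique H) (0<H : All (0 <_) H) (2≤r : 2 ≤ length H)
  (hr∈H : hr ∈ H) (H≤hr : ∀ h → h ∈ H → h ≤ hr)
  (|HA|≤ : cardHA H A ≤ length H + hr * length (s ∷ xs))
  where

  private instance
    g≢0 : NonZero g
    g≢0 = >-nonZero 0<g

  canonical : List ℕ
  canonical = map (_* g) H ++ chain hr (g ∷ s ∷ xs)

  multiples≤ : ∀ {x} → x ∈ map (_* g) H → x ≤ hr * g
  multiples≤ x∈ with ∈-map⁻ (_* g) x∈
  ... | h , h∈H , refl = *-monoˡ-≤ g (H≤hr h h∈H)

  HA⊆canonical : HA H A ⊆ canonical
  HA⊆canonical = ⊇-by-length canonical! canonical⊆HA (≤-trans |HA|≤ (≤-reflexive (sym |canonical|)))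
    where
    canonical! : Unique canonical
    canonical! = Unique.++⁺ (Unique.map⁺ (λ {x} {y} → *-cancelʳ-≡ x y g) H!) (AllPairs.map <⇒≢ (chain-↑ S↑))
      (λ (x∈multiples , x∈chain) → <⇒≱ (chain-above S↑ x∈chain) (multiples≤ x∈multiples))
    canonical⊆HA : canonical ⊆ HA H A
    canonical⊆HA x∈ with ∈-++⁻ (map (_* g) H) x∈
    ... | inj₂ x∈chain = ∈-HA⁺ hr∈H (chain⊆· S↑ S⊆A x∈chain)
    ... | inj₁ x∈multiples with ∈-map⁻ (_* g) x∈multiples
    ...   | h , h∈H , refl = ∈-HA⁺ h∈H (∈-·-*⁺ h (All.head S⊆A))
    |canonical| : length canonical ≡ length H + hr * length (s ∷ xs)
    |canonical| =
      trans (length-++ (map (_* g) H)) (cong₂ _+_ (length-map (_* g) H) (length-chain hr g (s ∷ xs)))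

  covers : ChainCovers A hr g (s ∷ xs)
  covers x∈hA hr*g<x with ∈-++⁻ (map (_* g) H) (HA⊆canonical (∈-HA⁺ hr∈H x∈hA))
  ... | inj₁ x∈multiples = ⊥-elim (<⇒≱ hr*g<x (multiples≤ x∈multiples))
  ... | inj₂ x∈chain = x∈chain

  δ : ℕ
  δ = s ∸ g

  2≤hr : 2 ≤ hr
  2≤hr with ∃-below-max H! 2≤r H≤hr
  ... | q , q∈H , q<hr = ≤-trans (s≤s (All.lookup 0<H q∈H)) q<hr

  S-linked : Linked (Step δ) (g ∷ s ∷ xs)
  S-linked = ChainCovers⇒Linked 2≤hr S↑ S⊆A covers

  0<δ : 0 < δ
  0<δ = m<n⇒0<n∸m (All.head (AllPairs.head S↑))

  qg+δ∈qA : ∀ {q} → 0 < q → q * g + δ ∈ q · A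
  qg+δ∈qA {suc q} _ =
    subst (_∈ suc q · A) s+qg≡ (∈-·-suc⁺ q (All.lookup S⊆A (there (here refl))) (∈-·-*⁺ q (All.head S⊆A)))
    where
    regroup : ∀ g δ q → g + δ + q * g ≡ suc q * g + δ
    regroup = solve-∀
    s+qg≡ : s + q * g ≡ suc q * g + δ
    s+qg≡ = trans (cong (_+ q * g) (sym (m+[n∸m]≡n (<⇒≤ (All.head (AllPairs.head S↑)))))) (regroup g δ q)

  shift-is-multiple : ∀ {q} → q ∈ H → q < hr → ∃ λ y → y ∈ H × q * g + δ ≡ y * g
  shift-is-multiple {q} q∈H q<hr
    with ∈-++⁻ (map (_* g) H) (HA⊆canonical (∈-HA⁺ q∈H (qg+δ∈qA (All.lookup 0<H q∈H))))
  ... | inj₁ x∈multiples = ∈-map⁻ (_* g) x∈multiples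
  ... | inj₂ x∈chain with chain-of-Linked S-linked x∈chain
  ...   | t , x≡ = ⊥-elim (<-irrefl x≡ (begin-strict
    q * g + δ            <⟨ +-monoˡ-< δ (*-monoˡ-< g q<hr) ⟩
    hr * g + δ           ≤⟨ +-monoʳ-≤ (hr * g) (m≤m+n δ (t * δ)) ⟩
    hr * g + suc t * δ   ∎))
    where open ≤-Reasoning

  δ-multiple : ∃ λ e → 0 < e × δ ≡ e * g
  δ-multiple with ∃-below-max H! 2≤r H≤hr
  ... | q , q∈H , q<hr with shift-is-multiple q∈H q<hr
  ... | y , _ , qg+δ≡yg = y ∸ q , m<n⇒0<n∸m q<y , sym (begin
    (y ∸ q) * g          ≡⟨ *-distribʳ-∸ g y q ⟩
    y * g ∸ q * g        ≡⟨ cong (_∸ q * g) (sym qg+δ≡yg) ⟩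
    q * g + δ ∸ q * g    ≡⟨ m+n∸m≡n (q * g) δ ⟩
    δ                    ∎)
    where
    open ≡-Reasoning
    q<y : q < y
    q<y = *-cancelʳ-< g q y (≤-trans (m<m+n (q * g) 0<δ) (≤-reflexive qg+δ≡yg))

  module _ {e : ℕ} (0<e : 0 < e) (δ≡e*g : δ ≡ e * g) where

    H-closed : ∀ {q} → q ∈ H → q < hr → q + e ∈ H
    H-closed {q} q∈H q<hr with shift-is-multiple q∈H q<hr
    ... | y , y∈H , qg+δ≡yg = subst (_∈ H) (*-cancelʳ-≡ y (q + e) g yg≡) y∈H
      where
      yg≡ : y * g ≡ (q + e) * g
      yg≡ = trans (sym qg+δ≡yg) (trans (cong (q * g +_) δ≡e*g) (sym (*-distribʳ-+ g q e)))

    H-IsAP : IsAP e H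
    H-IsAP = step-closed⇒IsAP 0<e hr∈H H≤hr H-closed H!

theorem4 : (A H : List ℕ) → Unique A → Unique H
    → All (0 <_) A → All (0 <_) H
    → 2 ≤ length A → 2 ≤ length H
    → (hr : ℕ) → hr ∈ H → (∀ h → h ∈ H → h ≤ hr)
    → cardHA H A ≡ hr * (length A ∸ 1) + length H
    → ∃ λ d → IsAP d H × (∀ m → m ∈ A → (∀ x → x ∈ A → m ≤ x) → IsAP (d * m) A)
theorem4 A H A! H! 0<A 0<H 2≤k 2≤r hr hr∈H H≤hr |HA|≡ =
  from-sorted (ascending A) (ascending-↑ A) (∈-ascending⇔ A) (length-ascending A!)
  where
  from-sorted : ∀ S → AllPairs _<_ S → (∀ {x} → x ∈ S ⇔ x ∈ A) → length S ≡ length A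
              → ∃ λ d → IsAP d H × (∀ m → m ∈ A → (∀ x → x ∈ A → m ≤ x) → IsAP (d * m) A)
  from-sorted [] _ _ |S|≡ with () ← subst (2 ≤_) (sym |S|≡) 2≤k
  from-sorted (_ ∷ []) _ _ |S|≡ with s≤s () ← subst (2 ≤_) (sym |S|≡) 2≤k
  from-sorted (g ∷ s ∷ xs) S↑ S⇔A |S|≡ = conclude δ-multiple
    where
    S⊆A : g ∷ s ∷ xs ⊆ A
    S⊆A = Equivalence.to S⇔A
    |HA|≤ : cardHA H A ≤ length H + hr * length (s ∷ xs)
    |HA|≤ = ≤-reflexive (trans |HA|≡
      (trans (cong (λ k → hr * (k ∸ 1) + length H) (sym |S|≡)) (+-comm _ (length H))))
    open Extremal S↑ (All.tabulate S⊆A) (All.lookup 0<A (S⊆A (here refl))) H! 0<H 2≤r hr∈H H≤hr |HA|≤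
    conclude : (∃ λ e → 0 < e × δ ≡ e * g)
             → ∃ λ d → IsAP d H × (∀ m → m ∈ A → (∀ x → x ∈ A → m ≤ x) → IsAP (d * m) A)
    conclude (e , 0<e , δ≡e*g) = e , H-IsAP 0<e δ≡e*g , λ m m∈A m≤A →
      subst (λ n → IsAP (e * n) A)
        (≤-antisym (head-≤ S↑ (Equivalence.from S⇔A m∈A)) (m≤A g (S⊆A (here refl))))
        (subst (λ d → IsAP d A) δ≡e*g (IsAP-resp (⇔.sym S⇔A) (sym |S|≡) (Linked-Step⇒IsAP S-linked)))
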